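{- Let $q\ge3$ be odd, let $\mathcal H$ be a $q$-uniform hypergraph on $[n]$, and let $\eta>0$. Then there is a collection $\{\mathcal H^\pi:\pi\in P\}$ of hypergraphs, with $|P|\le q\lceil\log_2|\mathcal H|\rceil+1$, such that: (1) for every $\pi\in P$ there exists $t\in[q]$ such that $\mathcal H^\pi$ is $t$-approximately strongly regular; (2) the $\mathcal H^\pi$ are pairwise disjoint and $\bigsqcup_{\pi\in P}\mathcal H^\pi\subseteq\mathcal H$; (3) $\big|\bigsqcup_{\pi\in P}\mathcal H^\pi\big|\ge(1-\eta)|\mathcal H|$; (4) $|\mathcal H^\pi|\ge\frac{\eta|\mathcal H|}{q\lceil\log_2|\mathcal H|\rceil+1}$ for all $\pi\in P$.
   Context: A $q$-uniform hypergraph on $[n]$ is a multiset of $q$-element subsets of $[n]$ (parallel hyperedges allowed), $|\mathcal H|$ counting multiplicity; sub-hypergraphs and disjoint unions are taken as sub-multisets. Co-degrees of a hypergraph $\mathcal G$: for $Q\subseteq[n]$, $d_{\mathcal G,Q}=|\{C\in\mathcal G:Q\subseteq C\}|$ and $d_r=d_{\mathcal G,r}=\max_{|Q|=r}d_{\mathcal G,Q}$. Good index: given $d_1\ge\cdots\ge d_q$, an index $t\in[q]$ is good if (1) $d_r/d_t\le n^{1-2r/q}$ for every $1\le r\le\lceil\frac{q-t}{2}\rceil$; (2) $d_r/d_t\le n^{ -\frac{2}{q}(r-t)+\frac1q(t-\mathbf 1(t\text{ even}))}$ for every $t\le r\le\lfloor\frac{q+t}{2}\rfloor$; (3) if $t<q/2$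 then $d_t\ge d_1 n^{ -\frac2q(t-1)}$, and if $t>q/2$ then $d_t\ge d_1 n^{ -1+2/q}$. A hypergraph $\mathcal G$ is $t$-approximately strongly regular if, writing $d_r=d_{\mathcal G,r}$, there is a partition $\mathcal G=\mathcal G_1\sqcup\cdots\sqcup\mathcal G_{p_t}$ such that (i) for each $\theta$ there is $Q_\theta\in\binom{[n]}{t}$ contained in every $C\in\mathcal G_\theta$; (ii) $d_t/2\le|\mathcal G_\theta|\le d_t$; (iii) $t$ is a good index with respect to $(d_1,\dots,d_q)$.
   Formalization: The parameter η ranges over the positive rationals. -}

module Defs where

open import Data.Nat using (ℕ; zero; suc; _+_; _*_; _∸_; _^_; _≤_; _<_; _⊔_; ⌈_/2⌉; ⌊_/2⌋)
open import Data.Integer using (ℤ; +_; -[1+_]; _-_)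
import Data.Integer as ℤ
open import Data.Fin using (Fin; zero; suc; _≟_)
open import Data.Fin.Subset using (Subset; _⊆_; ∣_∣)
open import Data.Fin.Subset.Properties using (_⊆?_)
open import Data.Bool using (true; false)
open import Data.List using (List; []; _∷_; map; filter; length; foldr; _++_; allFin; sum)
open import Data.List.Relation.Unary.All using (All)
open import Data.Vec using (_∷_; [])
open import Data.Maybe using (Maybe; just; nothing)
open import Data.Product using (Σ; ∃; ∃-syntax; _×_; _,_)
open import Relation.Nullary using (yes; no)
import Data.Nat as ℕ
open import Relation.Binary.PropositionalEquality using (_≡_)

-- A (multi-)hypergraph on [n] = Fin n: a list of hyperedges (list = multiset,
-- repetitions are parallel hyperedges); its size |G| is the length of the list.
Hypergraph : ℕ → Set
Hypergraph n = List (Subset n)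

Uniform : ∀ {n} → ℕ → Hypergraph n → Set
Uniform q G = All (λ C → ∣ C ∣ ≡ q) G

allSubsets : (n : ℕ) → List (Subset n)
allSubsets zero    = [] ∷ []
allSubsets (suc n) = map (true ∷_) (allSubsets n) ++ map (false ∷_) (allSubsets n)

codeg : ∀ {n} → Hypergraph n → Subset n → ℕ
codeg G Q = length (filter (λ C → Q ⊆? C) G)

-- d_r = max_{|Q| = r} d_{G,Q}   (0 if there is no such Q)
dmax : ∀ {n} → Hypergraph n → ℕ → ℕ
dmax {n} G r = foldr _⊔_ 0 (map (codeg G) (filter (λ Q → ∣ Q ∣ ℕ.≟ r) (allSubsets n)))

-- Sub-multiset selection: a labelling f assigns to each occurrence (index) of
-- G either no label or a label π ∈ Fin p; (labelled G f π) is the sub-hypergraph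
-- of hyperedges labelled π.  Families of pairwise disjoint sub-multisets of G
-- correspond exactly to such labellings.
labelled : ∀ {n p} (G : Hypergraph n) → (Fin (length G) → Maybe (Fin p)) → Fin p → Hypergraph n
labelled []      f π = []
labelled (C ∷ G) f π with f zero
... | nothing = labelled G (λ i → f (suc i)) π
... | just σ with σ ≟ π
...   | yes _ = C ∷ labelled G (λ i → f (suc i)) π
...   | no  _ = labelled G (λ i → f (suc i)) π

-- ScaledLe q n x y e  means   x ≤ y · n^(e/q)   (for x, y ≥ 0, real exponent e/q),
-- expressed exactly by raising both sides to the q-th power:
--   e ≥ 0 :  x^q ≤ y^q · n^e ;    e < 0 :  x^q · n^(-e) ≤ y^q.
ScaledLe : (q n x y : ℕ) → ℤ → Set
ScaledLe q n x y (+ k)    = x ^ q ≤ y ^ q * n ^ k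
ScaledLe q n x y -[1+ k ] = x ^ q * n ^ suc k ≤ y ^ q

evenInd : ℕ → ℕ
evenInd t = 1 ∸ (t ℕ.% 2)

-- t is a good index w.r.t. (d_1,…,d_q) = (d 1, …, d q), on [n].
-- "d_r / d_t ≤ n^a" is read as "d_r ≤ d_t · n^a".
Good : (q n : ℕ) → (d : ℕ → ℕ) → ℕ → Set
Good q n d t =
    (∀ r → 1 ≤ r → r ≤ ⌈ (q ∸ t) /2⌉ →
        ScaledLe q n (d r) (d t) (+ q - + (2 * r)))
  × (∀ r → t ≤ r → r ≤ ⌊ (q + t) /2⌋ →
        ScaledLe q n (d r) (d t) ((+ (2 * t) - + (2 * r)) ℤ.+ (+ t - + evenInd t)))
  × (2 * t < q → ScaledLe q n (d 1) (d t) (+ (2 * (t ∸ 1))))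
  × (q < 2 * t → ScaledLe q n (d 1) (d t) (+ (q ∸ 2)))

ApproxStronglyRegular : (q n t : ℕ) → Hypergraph n → Set
ApproxStronglyRegular q n t G =
  Σ ℕ λ p → Σ (Fin (length G) → Fin p) λ f →
    (∀ θ → (Σ (Subset n) λ Q → (∣ Q ∣ ≡ t) × All (λ C → Q ⊆ C) (labelled G (λ i → just (f i)) θ))
         × (dmax G t ≤ 2 * length (labelled G (λ i → just (f i)) θ))
         × (length (labelled G (λ i → just (f i)) θ) ≤ dmax G t))
    × Good q n (dmax G) t

{-# OPTIONS --safe #-}
module Submission where

-- The pieces are extracted one at a time. For the remaining hypergraph G with maximal
-- co-degrees d_r, a good index t exists: among 1 ≤ r ≤ (q-1)/2 let t maximise d_r^q n^(2r);
-- if d_((q+1)/2)^q n^(q+1) is at least n times that maximum, (q+1)/2 is good, otherwise t is.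
-- Starting with a t-set of co-degree d = d_t, greedily pick t-sets ("centres") of co-degree
-- at least d/2 in what is not yet covered; the hyperedges containing a centre, each grouped
-- with the first centre it contains, form the piece. Its t-th co-degree is still d and its
-- other co-degrees can only drop, so t stays good for it; in the rest every t-set has
-- co-degree below d/2. Thus Σ_r ⌈log₂ d_r⌉ ≤ q⌈log₂|H|⌉ decreases with every piece, so there
-- are at most q⌈log₂|H|⌉+1 pieces; discarding those with fewer than η|H|/(q⌈log₂|H|⌉+1)
-- hyperedges loses at most η|H| hyperedges.

module Labellings where

  open import Data.Nat using (ℕ; zero; suc; _+_; _*_; _≤_; _<_; z≤n; s≤s; s≤s⁻¹; _≤?_)
  open import Data.Nat.Properties
  open import Algebra.Properties.CommutativeSemigroup +-commutativeSemigroup using (x∙yz≈y∙xz)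
  open import Data.Nat.ListAction using (sum)
  open import Data.Fin using (Fin; zero; suc)
  import Data.Fin as Fin
  open import Data.List using (List; []; _∷_; map; filter; length; allFin)
  open import Data.List.Properties using (map-cong; map-tabulate)
  open import Data.List.Relation.Unary.All using (All)
  open import Data.List.Relation.Unary.All.Properties using (all-filter)
  open import Data.Maybe using (Maybe; just; nothing; Is-just; fromMaybe)
  import Data.Maybe as Maybe
  import Data.Maybe.Relation.Unary.Any as MaybeAny
  open import Data.Maybe.Properties using (≡-dec)
  open import Data.Unit using (tt)
  open import Data.Empty using (⊥-elim)
  open import Function using (_∘_; id)
  open import Relation.Nullary using (yes; no)
  open import Relation.Unary using (Decidable)
  open import Relation.Unary.Properties using (∁?)
  open import Data.Product using (_×_; _,_)
  open import Relation.Binary.PropositionalEquality using (_≡_; _≢_; refl; sym; trans; cong; cong₂; subst)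

  module _ {A : Set} {P Q : A → Set} (P? : Decidable P) (Q? : Decidable Q) where

    filter-absorb : (∀ {x} → P x → Q x) → ∀ xs → filter P? (filter Q? xs) ≡ filter P? xs
    filter-absorb P⊆Q [] = refl
    filter-absorb P⊆Q (x ∷ xs) with Q? x
    ... | no ¬q with P? x
    ...   | yes p = ⊥-elim (¬q (P⊆Q p))
    ...   | no _  = filter-absorb P⊆Q xs
    filter-absorb P⊆Q (x ∷ xs) | yes _ with P? x
    ...   | yes _ = cong (x ∷_) (filter-absorb P⊆Q xs)
    ...   | no _  = filter-absorb P⊆Q xs

  module _ {A : Set} {P : A → Set} (P? : Decidable P) where

    length-filter-split : ∀ xs → length xs ≡ length (filter P? xs) + length (filter (∁? P?) xs)
    length-filter-split [] = refl
    length-filter-split (x ∷ xs) with P? x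
    ... | yes _ = cong suc (length-filter-split xs)
    ... | no _  = trans (cong suc (length-filter-split xs)) (sym (+-suc _ _))

  sum-map-allFin-suc : ∀ {p} (g : Fin (suc p) → ℕ) →
                       sum (map g (allFin (suc p))) ≡ g zero + sum (map (g ∘ suc) (allFin p))
  sum-map-allFin-suc g =
    cong (g zero +_) (cong sum (trans (map-tabulate suc g) (sym (map-tabulate id (g ∘ suc)))))

  module _ {A : Set} {p : ℕ} where

    piece : (A → Maybe (Fin p)) → List A → Fin p → List A
    piece label xs π = filter (λ x → ≡-dec Fin._≟_ (label x) (just π)) xs

    coverage : (A → Maybe (Fin p)) → List A → ℕ
    coverage label xs = sum (map (λ π → length (piece label xs π)) (allFin p))

  all-piece : ∀ {A : Set} {p} (label : A → Maybe (Fin p)) xs π →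
              All (λ x → label x ≡ just π) (piece label xs π)
  all-piece label xs π = all-filter (λ x → ≡-dec Fin._≟_ (label x) (just π)) xs

  is-just? : ∀ {B : Set} → Decidable (Is-just {A = B})
  is-just? = MaybeAny.dec (λ _ → yes tt)

  piece-fromMaybe : ∀ {A : Set} {k} (label : A → Maybe (Fin (suc k))) xs π →
                    piece (just ∘ fromMaybe zero ∘ label) (filter (is-just? ∘ label) xs) π ≡ piece label xs π
  piece-fromMaybe label [] π = refl
  piece-fromMaybe label (x ∷ xs) π with label x in labelled-x
  ... | nothing = piece-fromMaybe label xs π
  ... | just σ rewrite labelled-x with σ Fin.≟ π
  ...   | yes _ = cong (x ∷_) (piece-fromMaybe label xs π)
  ...   | no _  = piece-fromMaybe label xs π

  module _ {A : Set} {D : A → Set} (D? : Decidable D) {p : ℕ} (label : A → Maybe (Fin p)) where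

    addClass : A → Maybe (Fin (suc p))
    addClass x with D? x
    ... | yes _ = just zero
    ... | no _  = Maybe.map suc (label x)

    leaveOut : A → Maybe (Fin p)
    leaveOut x with D? x
    ... | yes _ = nothing
    ... | no _  = label x

    piece-addClass-zero : ∀ xs → piece addClass xs zero ≡ filter D? xs
    piece-addClass-zero [] = refl
    piece-addClass-zero (x ∷ xs) with D? x
    ... | yes _ = cong (x ∷_) (piece-addClass-zero xs)
    ... | no _ with label x
    ...   | nothing = piece-addClass-zero xs
    ...   | just _  = piece-addClass-zero xs

    piece-addClass-suc : ∀ xs π → piece addClass xs (suc π) ≡ piece label (filter (∁? D?) xs) π
    piece-addClass-suc [] π = refl
    piece-addClass-suc (x ∷ xs) π with D? x
    ... | yes _ = piece-addClass-suc xs π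
    ... | no _ with label x
    ...   | nothing = piece-addClass-suc xs π
    ...   | just σ with σ Fin.≟ π
    ...     | yes _ = cong (x ∷_) (piece-addClass-suc xs π)
    ...     | no _  = piece-addClass-suc xs π

    piece-leaveOut : ∀ xs π → piece leaveOut xs π ≡ piece label (filter (∁? D?) xs) π
    piece-leaveOut [] π = refl
    piece-leaveOut (x ∷ xs) π with D? x
    ... | yes _ = piece-leaveOut xs π
    ... | no _ with label x
    ...   | nothing = piece-leaveOut xs π
    ...   | just σ with σ Fin.≟ π
    ...     | yes _ = cong (x ∷_) (piece-leaveOut xs π)
    ...     | no _  = piece-leaveOut xs π

    coverage-addClass : ∀ xs → coverage addClass xs ≡ length (filter D? xs) + coverage label (filter (∁? D?) xs)
    coverage-addClass xs =
      trans (sum-map-allFin-suc (λ π → length (piece addClass xs π)))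
            (cong₂ _+_ (cong length (piece-addClass-zero xs))
                       (cong sum (map-cong (λ π → cong length (piece-addClass-suc xs π)) (allFin p))))

    coverage-leaveOut : ∀ xs → coverage leaveOut xs ≡ coverage label (filter (∁? D?) xs)
    coverage-leaveOut xs = cong sum (map-cong (λ π → cong length (piece-leaveOut xs π)) (allFin p))

  module Peeling {A : Set} (Acceptable : List A → Set) where

    record Peel (Invariant : List A → Set) (measure : List A → ℕ) (xs : List A) : Set₁ where
      field
        Taken      : A → Set
        taken?     : Decidable Taken
        accepted   : Acceptable (filter taken? xs)
        invariant  : Invariant (filter (∁? taken?) xs)
        decreasing : filter (∁? taken?) xs ≢ [] → measure (filter (∁? taken?) xs) < measure xs

    module _ (X Y : ℕ) where

      -- X / Y is the least size of a kept piece; each discarded piece is smaller, which is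
      -- what nearly-covering accounts for.
      Admissible : List A → Set
      Admissible P = Acceptable P × X ≤ Y * length P

      record Decomposition (xs : List A) (budget : ℕ) : Set where
        field
          pieces dropped  : ℕ
          label           : A → Maybe (Fin pieces)
          within-budget   : pieces + dropped ≤ budget
          admissible      : ∀ π → Admissible (piece label xs π)
          nearly-covering : Y * length xs ≤ Y * coverage label xs + dropped * X

      empty : ∀ {budget} → Decomposition [] budget
      empty = record
        { pieces = 0 ; dropped = 0 ; label = λ _ → nothing ; within-budget = z≤n
        ; admissible = λ () ; nearly-covering = m≤m+n (Y * 0) 0 }

      module _ {D : A → Set} (D? : Decidable D) {xs budget} (rest : Decomposition (filter (∁? D?) xs) budget) where

        open Decomposition rest
        open ≤-Reasoning

        private
          t r c : ℕ
          t = length (filter D? xs)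
          r = length (filter (∁? D?) xs)
          c = coverage label (filter (∁? D?) xs)

          split : Y * length xs ≡ Y * t + Y * r
          split = trans (cong (Y *_) (length-filter-split D? xs)) (*-distribˡ-+ Y t r)

        keep : Admissible (filter D? xs) → Decomposition xs (suc budget)
        keep taken = record
          { pieces = suc pieces ; dropped = dropped ; label = addClass D? label
          ; within-budget = s≤s within-budget
          ; admissible = λ { zero    → subst Admissible (sym (piece-addClass-zero D? label xs)) taken
                           ; (suc π) → subst Admissible (sym (piece-addClass-suc D? label xs π)) (admissible π) }
          ; nearly-covering = begin
              Y * length xs                 ≡⟨ split ⟩
              Y * t + Y * r                 ≤⟨ +-monoʳ-≤ (Y * t) nearly-covering ⟩
              Y * t + (Y * c + dropped * X) ≡⟨ +-assoc (Y * t) _ _ ⟨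
              Y * t + Y * c + dropped * X   ≡⟨ cong (_+ dropped * X) (*-distribˡ-+ Y t c) ⟨
              Y * (t + c) + dropped * X     ≡⟨ cong (λ k → Y * k + dropped * X) (coverage-addClass D? label xs) ⟨
              Y * coverage (addClass D? label) xs + dropped * X ∎ }

        discard : Y * t < X → Decomposition xs (suc budget)
        discard small = record
          { pieces = pieces ; dropped = suc dropped ; label = leaveOut D? label
          ; within-budget = ≤-trans (≤-reflexive (+-suc pieces dropped)) (s≤s within-budget)
          ; admissible = λ π → subst Admissible (sym (piece-leaveOut D? label xs π)) (admissible π)
          ; nearly-covering = begin
              Y * length xs             ≡⟨ split ⟩
              Y * t + Y * r             ≤⟨ +-mono-≤ (<⇒≤ small) nearly-covering ⟩
              X + (Y * c + dropped * X) ≡⟨ x∙yz≈y∙xz X (Y * c) (dropped * X) ⟩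
              Y * c + suc dropped * X   ≡⟨ cong (λ k → Y * k + suc dropped * X) (coverage-leaveOut D? label xs) ⟨
              Y * coverage (leaveOut D? label) xs + suc dropped * X ∎ }

      peel : ∀ {D : A → Set} (D? : Decidable D) {xs budget} → Acceptable (filter D? xs) →
             Decomposition (filter (∁? D?) xs) budget → Decomposition xs (suc budget)
      peel D? {xs} accepted rest with X ≤? Y * length (filter D? xs)
      ... | yes large = keep D? rest (accepted , large)
      ... | no small  = discard D? rest (≰⇒> small)

      decompose : ∀ {Invariant measure} → (∀ {xs} → xs ≢ [] → Invariant xs → Peel Invariant measure xs) →
                  ∀ budget xs → Invariant xs → (xs ≢ [] → measure xs < budget) → Decomposition xs budget
      decompose step budget       []       _   _         = empty
      decompose step zero         (x ∷ xs) _   in-budget = ⊥-elim (n≮0 (in-budget λ ()))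
      decompose step (suc budget) (x ∷ xs) inv in-budget =
        peel taken? accepted (decompose step budget _ invariant rest-in-budget)
        where
        open Peel (step (λ ()) inv)
        rest-in-budget : filter (∁? taken?) (x ∷ xs) ≢ [] → _ < budget
        rest-in-budget nonempty = <-≤-trans (decreasing nonempty) (s≤s⁻¹ (in-budget λ ()))

module Regularisation where

  open import Defs
  open Labellings
  open import Data.Nat
    using (ℕ; zero; suc; _+_; _*_; _∸_; _^_; _≤_; _<_; _≥_; _%_; _⊔_; z≤n; s≤s; s≤s⁻¹; _≤?_; NonZero; >-nonZero; ⌈_/2⌉; ⌊_/2⌋)
  import Data.Nat as ℕ
  import Data.Nat.DivMod as ℕ
  open import Data.Nat.Properties
  open import Algebra.Properties.CommutativeSemigroup *-commutativeSemigroup using (x∙yz≈y∙xz)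
  open import Data.Nat.Tactic.RingSolver using (solve-∀)
  open import Data.Nat.Logarithm using (⌈log₂_⌉; ⌈log₂⌉-mono-≤; ⌈log₂2*n⌉≡1+⌈log₂n⌉)
  open import Data.Integer using (ℤ; +_; -[1+_])
  import Data.Integer as ℤ
  import Data.Integer.Properties as ℤ
  import Data.Integer.Tactic.RingSolver as ℤ-Solver
  open import Data.Fin using (Fin; zero; suc)
  import Data.Fin as Fin
  open import Data.Fin.Subset using (Subset; _⊆_; ∣_∣; ⊤; inside; outside)
  open import Data.Fin.Subset.Properties using (_⊆?_; ⊆-trans; ∣p∣≤n; ∣⊤∣≡n)
  open import Data.List using (List; []; _∷_; map; filter; length; lookup; foldr; applyUpTo)
  open import Data.List.Properties using (length-filter; filter-some; filter-none; filter-all)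
  open import Data.List.Extrema.Nat using (argmax; argmax-all; f[xs]≤f[argmax])
  open import Data.List.Relation.Unary.All.Properties using (applyUpTo⁺₁; applyUpTo⁻; all-filter)
  open import Data.List.Membership.Propositional using (_∈_)
  open import Data.List.Membership.Propositional.Properties
    using (∈-filter⁺; ∈-filter⁻; ∈-map⁺; ∈-++⁺ˡ; ∈-++⁺ʳ; ∈-lookup)
  open import Data.List.Relation.Unary.Any using (here; there)
  open import Data.List.Relation.Unary.All using (All; []; _∷_)
  import Data.List.Relation.Unary.All as All
  open import Data.List.Relation.Binary.Sublist.Propositional using () renaming (_⊆_ to _⊑_; ⊆-refl to ⊑-refl)
  import Data.List.Relation.Binary.Sublist.Propositional.Properties as Sublist
  open import Data.List.Relation.Binary.Sublist.Heterogeneous.Properties using (length-mono-≤)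
  open import Data.Vec using (_∷_; []; here; there)
  open import Data.Product using (Σ; ∃-syntax; _×_; _,_; proj₁; proj₂)
  open import Data.Sum using (inj₁; inj₂)
  open import Data.Empty using (⊥-elim)
  open import Function using (_∘_; id)
  open import Relation.Nullary using (yes; no)
  open import Relation.Unary using (Decidable)
  open import Relation.Unary.Properties using (∁?)
  open import Data.Maybe using (Maybe; just; nothing; Is-just; fromMaybe)
  import Data.Maybe as Maybe
  import Data.Maybe.Relation.Unary.Any as MaybeAny
  open import Data.Unit using (tt)
  open import Relation.Binary.PropositionalEquality
    using (_≡_; _≢_; refl; sym; trans; cong; cong₂; subst; subst₂; module ≡-Reasoning)
  import Data.List.Relation.Unary.All.Properties as All

  -- Co-degrees

  subset-ofSize : ∀ {n} (C : Subset n) {k} → k ≤ ∣ C ∣ → ∃[ Q ] Q ⊆ C × ∣ Q ∣ ≡ k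
  subset-ofSize []            {zero}  _         = [] , (λ ()) , refl
  subset-ofSize (outside ∷ C) {k}     k≤∣C∣     with subset-ofSize C k≤∣C∣
  ... | Q , Q⊆C , ∣Q∣≡k = outside ∷ Q , (λ { (there i) → there (Q⊆C i) }) , ∣Q∣≡k
  subset-ofSize (inside ∷ C)  {zero}  _         with subset-ofSize C z≤n
  ... | Q , Q⊆C , ∣Q∣≡0 = outside ∷ Q , (λ { (there i) → there (Q⊆C i) }) , ∣Q∣≡0
  subset-ofSize (inside ∷ C)  {suc k} (s≤s k≤∣C∣) with subset-ofSize C k≤∣C∣
  ... | Q , Q⊆C , ∣Q∣≡k = inside ∷ Q , (λ { here → here ; (there i) → there (Q⊆C i) }) , cong suc ∣Q∣≡k

  ∈-allSubsets : ∀ {n} (Q : Subset n) → Q ∈ allSubsets n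
  ∈-allSubsets []                   = here refl
  ∈-allSubsets {suc n} (inside ∷ Q)  = ∈-++⁺ˡ (∈-map⁺ (inside ∷_) (∈-allSubsets Q))
  ∈-allSubsets {suc n} (outside ∷ Q) =
    ∈-++⁺ʳ (map (inside ∷_) (allSubsets n)) (∈-map⁺ (outside ∷_) (∈-allSubsets Q))

  module _ {A : Set} (f : A → ℕ) where

    maxOf : List A → ℕ
    maxOf xs = foldr _⊔_ 0 (map f xs)

    ≤-maxOf : ∀ {x xs} → x ∈ xs → f x ≤ maxOf xs
    ≤-maxOf {xs = y ∷ _}  (here refl) = m≤m⊔n (f y) _
    ≤-maxOf {xs = y ∷ xs} (there x∈xs) = ≤-trans (≤-maxOf x∈xs) (m≤n⊔m (f y) _)

    maxOf-≤ : ∀ {b} xs → (∀ {x} → x ∈ xs → f x ≤ b) → maxOf xs ≤ b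
    maxOf-≤ []       _       = z≤n
    maxOf-≤ (x ∷ xs) bounded = ⊔-lub (bounded (here refl)) (maxOf-≤ xs (bounded ∘ there))

    maxOf-attained : ∀ {x xs} → x ∈ xs → ∃[ y ] y ∈ xs × f y ≡ maxOf xs
    maxOf-attained {xs = y ∷ ys} _ = attained y ys
      where
      attained : ∀ y ys → ∃[ z ] z ∈ y ∷ ys × f z ≡ maxOf (y ∷ ys)
      attained y [] = y , here refl , sym (⊔-identityʳ (f y))
      attained y (y′ ∷ ys) with ⊔-sel (f y) (maxOf (y′ ∷ ys))
      ... | inj₁ fy≡max = y , here refl , sym fy≡max
      ... | inj₂ max≡rest with attained y′ ys
      ...   | z , z∈ , fz≡ = z , there z∈ , trans fz≡ (sym max≡rest)

  module _ {n : ℕ} where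

    subsetsOfSize : ℕ → List (Subset n)
    subsetsOfSize r = filter (λ Q → ∣ Q ∣ ℕ.≟ r) (allSubsets n)

    ∈-subsetsOfSize : ∀ Q {r} → ∣ Q ∣ ≡ r → Q ∈ subsetsOfSize r
    ∈-subsetsOfSize Q ∣Q∣≡r = ∈-filter⁺ (λ Q → ∣ Q ∣ ℕ.≟ _) (∈-allSubsets Q) ∣Q∣≡r

    ∈-subsetsOfSize⁻ : ∀ {Q r} → Q ∈ subsetsOfSize r → ∣ Q ∣ ≡ r
    ∈-subsetsOfSize⁻ {r = r} Q∈ = proj₂ (∈-filter⁻ (λ Q → ∣ Q ∣ ℕ.≟ r) {xs = allSubsets n} Q∈)

    codeg≤dmax : ∀ (G : Hypergraph n) Q {r} → ∣ Q ∣ ≡ r → codeg G Q ≤ dmax G r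
    codeg≤dmax G Q ∣Q∣≡r = ≤-maxOf (codeg G) (∈-subsetsOfSize Q ∣Q∣≡r)

    dmax-lub : ∀ (G : Hypergraph n) r {b} → (∀ Q → ∣ Q ∣ ≡ r → codeg G Q ≤ b) → dmax G r ≤ b
    dmax-lub G r bounded = maxOf-≤ (codeg G) (subsetsOfSize r) (λ Q∈ → bounded _ (∈-subsetsOfSize⁻ Q∈))

    dmax-attained : ∀ (G : Hypergraph n) {r} → r ≤ n → ∃[ Q ] ∣ Q ∣ ≡ r × codeg G Q ≡ dmax G r
    dmax-attained G r≤n with subset-ofSize ⊤ (subst (_ ≤_) (sym (∣⊤∣≡n n)) r≤n)
    ... | Q₀ , _ , ∣Q₀∣≡r with maxOf-attained (codeg G) (∈-subsetsOfSize Q₀ ∣Q₀∣≡r)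
    ...   | Q , Q∈ , attains = Q , ∈-subsetsOfSize⁻ Q∈ , attains

    codeg-mono : ∀ {G′ G : Hypergraph n} → G′ ⊑ G → ∀ Q → codeg G′ Q ≤ codeg G Q
    codeg-mono G′⊑G Q = length-mono-≤ (Sublist.filter⁺ (Q ⊆?_) (Q ⊆?_) (λ { refl → id }) G′⊑G)

    codeg-antitone : ∀ (G : Hypergraph n) Q′ Q → Q′ ⊆ Q → codeg G Q ≤ codeg G Q′
    codeg-antitone G Q′ Q Q′⊆Q =
      length-mono-≤ (Sublist.filter⁺ (Q ⊆?_) (Q′ ⊆?_) (λ { refl → ⊆-trans Q′⊆Q }) (⊑-refl {x = G}))

    dmax-mono : ∀ {G′ G : Hypergraph n} → G′ ⊑ G → ∀ r → dmax G′ r ≤ dmax G r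
    dmax-mono {G′} {G} G′⊑G r =
      dmax-lub G′ r (λ Q ∣Q∣≡r → ≤-trans (codeg-mono G′⊑G Q) (codeg≤dmax G Q ∣Q∣≡r))

    dmax-antitone : ∀ (G : Hypergraph n) {r s} → r ≤ s → dmax G s ≤ dmax G r
    dmax-antitone G r≤s = dmax-lub G _ λ Q ∣Q∣≡s →
      let (Q′ , Q′⊆Q , ∣Q′∣≡r) = subset-ofSize Q (subst (_ ≤_) (sym ∣Q∣≡s) r≤s)
      in ≤-trans (codeg-antitone G Q′ Q Q′⊆Q) (codeg≤dmax G Q′ ∣Q′∣≡r)

    dmax≤length : ∀ (G : Hypergraph n) r → dmax G r ≤ length G
    dmax≤length G r = dmax-lub G r (λ Q _ → length-filter (Q ⊆?_) G)

    edge-size≤n : ∀ {q} {G : Hypergraph n} → Uniform q G → G ≢ [] → q ≤ n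
    edge-size≤n {G = []}    _           G≢[] = ⊥-elim (G≢[] refl)
    edge-size≤n {G = C ∷ _} (∣C∣≡q ∷ _) _    = subst (_≤ n) ∣C∣≡q (∣p∣≤n C)

    dmax-positive : ∀ {q} {G : Hypergraph n} → Uniform q G → G ≢ [] → ∀ {r} → r ≤ q → 1 ≤ dmax G r
    dmax-positive {G = []}    _           G≢[] _   = ⊥-elim (G≢[] refl)
    dmax-positive {G = C ∷ G} (∣C∣≡q ∷ _) _    r≤q with subset-ofSize C (subst (_ ≤_) (sym ∣C∣≡q) r≤q)
    ... | Q , Q⊆C , ∣Q∣≡r = ≤-trans (filter-some (Q ⊆?_) (here Q⊆C)) (codeg≤dmax (C ∷ G) Q ∣Q∣≡r)

  -- Good indices

  argmax-between : (f : ℕ → ℕ) (m : ℕ) → 1 ≤ m →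
                   ∃[ t ] 1 ≤ t × t ≤ m × (∀ r → 1 ≤ r → r ≤ m → f r ≤ f t)
  argmax-between f m 1≤m = t , proj₁ in-range , proj₂ in-range , maximal
    where
    t : ℕ
    t = argmax f 1 (applyUpTo suc m)
    in-range : 1 ≤ t × t ≤ m
    in-range = argmax-all f {P = λ r → 1 ≤ r × r ≤ m} (≤-refl , 1≤m)
                 (applyUpTo⁺₁ suc m (λ i<m → s≤s z≤n , i<m))
    maximal : ∀ r → 1 ≤ r → r ≤ m → f r ≤ f t
    maximal (suc i) _ i<m = applyUpTo⁻ {P = λ r → f r ≤ f t} suc m (f[xs]≤f[argmax] 1 (applyUpTo suc m)) i<m

  ScaledLe-intro : ∀ q n x y a b e .{{_ : NonZero n}} → e ℤ.+ + a ≡ + b →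
                   x ^ q * n ^ a ≤ y ^ q * n ^ b → ScaledLe q n x y e
  ScaledLe-intro q n x y a b (+ k) e+a≡b le = *-cancelʳ-≤ (x ^ q) (y ^ q * n ^ k) (n ^ a) {{m^n≢0 n a}}
    (subst (x ^ q * n ^ a ≤_) (begin
      y ^ q * n ^ b          ≡⟨ cong (λ c → y ^ q * n ^ c) (sym (ℤ.+-injective e+a≡b)) ⟩
      y ^ q * n ^ (k + a)    ≡⟨ cong (y ^ q *_) (^-distribˡ-+-* n k a) ⟩
      y ^ q * (n ^ k * n ^ a) ≡⟨ *-assoc (y ^ q) _ _ ⟨
      y ^ q * n ^ k * n ^ a  ∎) le)
    where open ≡-Reasoning
  ScaledLe-intro q n x y a b -[1+ k ] e+a≡b le = *-cancelʳ-≤ (x ^ q * n ^ suc k) (y ^ q) (n ^ b) {{m^n≢0 n b}}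
    (subst (_≤ y ^ q * n ^ b) (begin
      x ^ q * n ^ a               ≡⟨ cong (λ c → x ^ q * n ^ c) a≡ ⟩
      x ^ q * n ^ (suc k + b)     ≡⟨ cong (x ^ q *_) (^-distribˡ-+-* n (suc k) b) ⟩
      x ^ q * (n ^ suc k * n ^ b) ≡⟨ *-assoc (x ^ q) _ _ ⟨
      x ^ q * n ^ suc k * n ^ b   ∎) le)
    where
    open ≡-Reasoning
    move : ∀ (e a : ℤ) → a ≡ ℤ.- e ℤ.+ (e ℤ.+ a)
    move = ℤ-Solver.solve-∀
    a≡ : a ≡ suc k + b
    a≡ = ℤ.+-injective (trans (move -[1+ k ] (+ a)) (cong (ℤ._+_ (+ suc k)) e+a≡b))

  ScaledLe-mono : ∀ q n {x y x′ y′} e → ScaledLe q n x y e → x′ ≤ x → y ≤ y′ → ScaledLe q n x′ y′ e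
  ScaledLe-mono q n (+ k) le x′≤x y≤y′ =
    ≤-trans (^-monoˡ-≤ q x′≤x) (≤-trans le (*-monoˡ-≤ (n ^ k) (^-monoˡ-≤ q y≤y′)))
  ScaledLe-mono q n -[1+ k ] le x′≤x y≤y′ =
    ≤-trans (*-monoˡ-≤ (n ^ suc k) (^-monoˡ-≤ q x′≤x)) (≤-trans le (^-monoˡ-≤ q y≤y′))

  Good-mono : ∀ {q n d d′ t} → Good q n d t → d t ≤ d′ t → (∀ r → d′ r ≤ d r) → Good q n d′ t
  Good-mono {q} {n} {t = t} (low , middle , small , large) dt≤d′t d′≤d =
    (λ r p p′ → ScaledLe-mono q n (+ q ℤ.- + (2 * r)) (low r p p′) (d′≤d r) dt≤d′t) ,
    (λ r p p′ → ScaledLe-mono q n ((+ (2 * t) ℤ.- + (2 * r)) ℤ.+ (+ t ℤ.- + evenInd t))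
                              (middle r p p′) (d′≤d r) dt≤d′t) ,
    (λ p → ScaledLe-mono q n (+ (2 * (t ∸ 1))) (small p) (d′≤d 1) dt≤d′t) ,
    (λ p → ScaledLe-mono q n (+ (q ∸ 2)) (large p) (d′≤d 1) dt≤d′t)

  ⌈[1+2m∸t]/2⌉≤m : ∀ m {t} → 1 ≤ t → ⌈ (suc (2 * m) ∸ t) /2⌉ ≤ m
  ⌈[1+2m∸t]/2⌉≤m m {suc t} _ = begin
    ⌈ (2 * m ∸ t) /2⌉ ≤⟨ ⌈n/2⌉-mono (m∸n≤m (2 * m) t) ⟩
    ⌈ m + (m + 0) /2⌉ ≡⟨ cong (λ k → ⌈ m + k /2⌉) (+-identityʳ m) ⟩
    ⌈ m + m /2⌉       ≡⟨ n≡⌈n+n/2⌉ m ⟨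
    m                 ∎
    where open ≤-Reasoning

  ⌊2k+j/2⌋≡k+⌊j/2⌋ : ∀ k j → ⌊ (2 * k + j) /2⌋ ≡ k + ⌊ j /2⌋
  ⌊2k+j/2⌋≡k+⌊j/2⌋ zero    j = refl
  ⌊2k+j/2⌋≡k+⌊j/2⌋ (suc k) j rewrite +-suc k (k + 0) = cong suc (⌊2k+j/2⌋≡k+⌊j/2⌋ k j)

  2⌊1+t/2⌋+evenInd≡1+t : ∀ t → 2 * ⌊ suc t /2⌋ + evenInd t ≡ suc t
  2⌊1+t/2⌋+evenInd≡1+t zero          = refl
  2⌊1+t/2⌋+evenInd≡1+t (suc zero)    = refl
  2⌊1+t/2⌋+evenInd≡1+t (suc (suc t)) =
    trans (cong (_+ evenInd t) (*-suc 2 ⌊ suc t /2⌋)) (cong (_+_ 2) (2⌊1+t/2⌋+evenInd≡1+t t))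

  2r+evenInd≤1+2m+t : ∀ m t {r} → r ≤ ⌊ (suc (2 * m) + t) /2⌋ → 2 * r + evenInd t ≤ suc (2 * m) + t
  2r+evenInd≤1+2m+t m t {r} r≤ = begin
    2 * r + evenInd t                       ≤⟨ +-monoˡ-≤ (evenInd t) (*-monoʳ-≤ 2 r≤) ⟩
    2 * ⌊ (suc (2 * m) + t) /2⌋ + evenInd t ≡⟨ cong (λ k → 2 * ⌊ k /2⌋ + evenInd t) (+-suc (2 * m) t) ⟨
    2 * ⌊ (2 * m + suc t) /2⌋ + evenInd t   ≡⟨ cong (λ k → 2 * k + evenInd t) (⌊2k+j/2⌋≡k+⌊j/2⌋ m (suc t)) ⟩
    2 * (m + ⌊ suc t /2⌋) + evenInd t       ≡⟨ cong (_+ evenInd t) (*-distribˡ-+ 2 m _) ⟩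
    2 * m + 2 * ⌊ suc t /2⌋ + evenInd t     ≡⟨ +-assoc (2 * m) _ _ ⟩
    2 * m + (2 * ⌊ suc t /2⌋ + evenInd t)   ≡⟨ cong (_+_ (2 * m)) (2⌊1+t/2⌋+evenInd≡1+t t) ⟩
    2 * m + suc t                           ≡⟨ +-suc (2 * m) t ⟩
    suc (2 * m) + t                         ∎
    where open ≤-Reasoning

  2[t∸1]+2≡2t : ∀ {t} → 1 ≤ t → 2 * (t ∸ 1) + 2 ≡ 2 * t
  2[t∸1]+2≡2t {t} 1≤t = begin
    2 * (t ∸ 1) + 2 ≡⟨ *-distribˡ-+ 2 (t ∸ 1) 1 ⟨
    2 * (t ∸ 1 + 1) ≡⟨ cong (2 *_) (m∸n+n≡m 1≤t) ⟩
    2 * t           ∎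
    where open ≡-Reasoning

  evenInd≤1 : ∀ t → evenInd t ≤ 1
  evenInd≤1 t = m∸n≤m 1 (t % 2)

  [x-y]+y≡x : ∀ x y → (+ x ℤ.- + y) ℤ.+ + y ≡ + x
  [x-y]+y≡x x y = cancel (+ x) (+ y)
    where
    cancel : ∀ (x y : ℤ) → (x ℤ.- y) ℤ.+ y ≡ x
    cancel = ℤ-Solver.solve-∀

  [x-y]+[y+c]≡x+c : ∀ x y c → (+ x ℤ.- + y) ℤ.+ + (y + c) ≡ + (x + c)
  [x-y]+[y+c]≡x+c x y c = cancel (+ x) (+ y) (+ c)
    where
    cancel : ∀ (x y c : ℤ) → (x ℤ.- y) ℤ.+ (y ℤ.+ c) ≡ x ℤ.+ c
    cancel = ℤ-Solver.solve-∀

  [x-y]+[z-w]+[y+w]≡x+z : ∀ x y z w → ((+ x ℤ.- + y) ℤ.+ (+ z ℤ.- + w)) ℤ.+ + (y + w) ≡ + (x + z)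
  [x-y]+[z-w]+[y+w]≡x+z x y z w = cancel (+ x) (+ y) (+ z) (+ w)
    where
    cancel : ∀ (x y z w : ℤ) → ((x ℤ.- y) ℤ.+ (z ℤ.- w)) ℤ.+ (y ℤ.+ w) ≡ x ℤ.+ z
    cancel = ℤ-Solver.solve-∀

  module GoodIndex (m n : ℕ) .{{_ : NonZero n}} (d : ℕ → ℕ) (d-antitone : ∀ {r s} → r ≤ s → d s ≤ d r) where

    q T : ℕ
    q = suc (2 * m)
    T = suc m

    2T≡q+1 : 2 * T ≡ q + 1
    2T≡q+1 = trans (*-suc 2 m) (cong suc (+-comm 1 (2 * m)))

    scaled : ℕ → ℕ → ℕ
    scaled r a = d r ^ q * n ^ a

    weight : ℕ → ℕ
    weight r = scaled r (2 * r)

    scaled-monoʳ : ∀ r {a b} → a ≤ b → scaled r a ≤ scaled r b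
    scaled-monoʳ r a≤b = *-monoʳ-≤ (d r ^ q) (^-monoʳ-≤ n a≤b)

    scaled-antitoneˡ : ∀ r s a → r ≤ s → scaled s a ≤ scaled r a
    scaled-antitoneˡ r s a r≤s = *-monoˡ-≤ (n ^ a) (^-monoˡ-≤ q (d-antitone r≤s))

    scaled-raise : ∀ r s a b k → scaled r a ≤ scaled s b → scaled r (a + k) ≤ scaled s (b + k)
    scaled-raise r s a b k le = begin
      d r ^ q * n ^ (a + k)     ≡⟨ cong (d r ^ q *_) (^-distribˡ-+-* n a k) ⟩
      d r ^ q * (n ^ a * n ^ k) ≡⟨ *-assoc (d r ^ q) _ _ ⟨
      scaled r a * n ^ k        ≤⟨ *-monoˡ-≤ (n ^ k) le ⟩
      scaled s b * n ^ k        ≡⟨ *-assoc (d s ^ q) _ _ ⟩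
      d s ^ q * (n ^ b * n ^ k) ≡⟨ cong (d s ^ q *_) (^-distribˡ-+-* n b k) ⟨
      d s ^ q * n ^ (b + k)     ∎
      where open ≤-Reasoning

    n*scaled : ∀ r a → n * scaled r a ≡ scaled r (a + 1)
    n*scaled r a = begin
      n * (d r ^ q * n ^ a) ≡⟨ x∙yz≈y∙xz n (d r ^ q) (n ^ a) ⟩
      scaled r (1 + a)      ≡⟨ cong (scaled r) (+-comm 1 a) ⟩
      scaled r (a + 1)      ∎
      where open ≡-Reasoning

    scaled-raise-≤ : ∀ {r s a b a′ b′} → scaled r a ≤ scaled s b → a ≤ a′ → a′ + b ≤ b′ + a →
                     scaled r a′ ≤ scaled s b′
    scaled-raise-≤ {r} {s} {a} {b} {a′} {b′} le a≤a′ slack = begin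
      scaled r a′       ≡⟨ cong (scaled r) (m+[n∸m]≡n a≤a′) ⟨
      scaled r (a + k)  ≤⟨ scaled-raise r s a b k le ⟩
      scaled s (b + k)  ≤⟨ scaled-monoʳ s (+-cancelˡ-≤ a (b + k) b′ a+[b+k]≤a+b′) ⟩
      scaled s b′       ∎
      where
      open ≤-Reasoning
      k : ℕ
      k = a′ ∸ a
      exchange : ∀ a b k → a + (b + k) ≡ (a + k) + b
      exchange = solve-∀
      a+[b+k]≤a+b′ : a + (b + k) ≤ a + b′
      a+[b+k]≤a+b′ = begin
        a + (b + k) ≡⟨ exchange a b k ⟩
        (a + k) + b ≡⟨ cong (_+ b) (m+[n∸m]≡n a≤a′) ⟩
        a′ + b      ≤⟨ slack ⟩
        b′ + a      ≡⟨ +-comm b′ a ⟩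
        a + b′      ∎

    [2r+evenInd]+[2t+1]≤[2t+t]+2T : ∀ t {r} → r ≤ ⌊ (q + t) /2⌋ →
                                    (2 * r + evenInd t) + (2 * t + 1) ≤ (2 * t + t) + 2 * T
    [2r+evenInd]+[2t+1]≤[2t+t]+2T t {r} r≤ = begin
      (2 * r + evenInd t) + (2 * t + 1) ≤⟨ +-monoˡ-≤ (2 * t + 1) (2r+evenInd≤1+2m+t m t r≤) ⟩
      (q + t) + (2 * t + 1)             ≡⟨ rearrange q t ⟩
      (2 * t + t) + (q + 1)             ≡⟨ cong (_+_ (2 * t + t)) 2T≡q+1 ⟨
      (2 * t + t) + 2 * T               ∎
      where
      open ≤-Reasoning
      rearrange : ∀ q t → (q + t) + (2 * t + 1) ≡ (2 * t + t) + (q + 1)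
      rearrange = solve-∀

    good-above : 1 ≤ m → (∀ r → 1 ≤ r → r ≤ m → n * weight r ≤ weight T) → Good q n d T
    good-above 1≤m dominated = low , middle , small , large
      where
      q≤2T : q ≤ 2 * T
      q≤2T = subst (q ≤_) (sym 2T≡q+1) (m≤m+n q 1)
      dominated′ : ∀ r → 1 ≤ r → r ≤ m → scaled r (2 * r + 1) ≤ scaled T (q + 1)
      dominated′ r 1≤r r≤m = subst₂ _≤_ (n*scaled r (2 * r)) (cong (scaled T) 2T≡q+1) (dominated r 1≤r r≤m)
      low : ∀ r → 1 ≤ r → r ≤ ⌈ (q ∸ T) /2⌉ → ScaledLe q n (d r) (d T) (+ q ℤ.- + (2 * r))
      low r 1≤r r≤ = ScaledLe-intro q n (d r) (d T) (2 * r + 1) (q + 1) (+ q ℤ.- + (2 * r))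
        ([x-y]+[y+c]≡x+c q (2 * r) 1)
        (dominated′ r 1≤r (≤-trans r≤ (⌈[1+2m∸t]/2⌉≤m m {T} (s≤s z≤n))))
      middle : ∀ r → T ≤ r → r ≤ ⌊ (q + T) /2⌋ →
               ScaledLe q n (d r) (d T) ((+ (2 * T) ℤ.- + (2 * r)) ℤ.+ (+ T ℤ.- + evenInd T))
      middle r T≤r r≤ = ScaledLe-intro q n (d r) (d T) (2 * r + evenInd T) (2 * T + T)
        ((+ (2 * T) ℤ.- + (2 * r)) ℤ.+ (+ T ℤ.- + evenInd T))
        ([x-y]+[z-w]+[y+w]≡x+z (2 * T) (2 * r) T (evenInd T))
        (≤-trans (scaled-antitoneˡ T r (2 * r + evenInd T) T≤r)
                 (scaled-monoʳ T (≤-trans (2r+evenInd≤1+2m+t m T r≤) (+-monoˡ-≤ T q≤2T))))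
      small : 2 * T < q → ScaledLe q n (d 1) (d T) (+ (2 * (T ∸ 1)))
      small 2T<q = ⊥-elim (<⇒≱ 2T<q q≤2T)
      q∸2+3≡q+1 : q ∸ 2 + 3 ≡ q + 1
      q∸2+3≡q+1 = trans (+-suc (q ∸ 2) 2)
                        (trans (cong suc (m∸n+n≡m (s≤s (≤-trans 1≤m (m≤m+n m (m + 0)))))) (+-comm 1 q))
      large : q < 2 * T → ScaledLe q n (d 1) (d T) (+ (q ∸ 2))
      large _ = ScaledLe-intro q n (d 1) (d T) 3 (q + 1) (+ (q ∸ 2)) (cong +_ q∸2+3≡q+1)
                               (dominated′ 1 ≤-refl 1≤m)

    good-below : ∀ {t} → 1 ≤ t → t ≤ m → (∀ r → 1 ≤ r → r ≤ m → weight r ≤ weight t) →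
                 weight T < n * weight t → Good q n d t
    good-below {t} 1≤t t≤m maximal T-light = low , middle , small , large
      where
      2t≤q : 2 * t ≤ q
      2t≤q = m≤n⇒m≤1+n (*-monoʳ-≤ 2 t≤m)
      T-light′ : scaled T (2 * T) ≤ scaled t (2 * t + 1)
      T-light′ = subst (scaled T (2 * T) ≤_) (n*scaled t (2 * t)) (<⇒≤ T-light)
      low : ∀ r → 1 ≤ r → r ≤ ⌈ (q ∸ t) /2⌉ → ScaledLe q n (d r) (d t) (+ q ℤ.- + (2 * r))
      low r 1≤r r≤ = ScaledLe-intro q n (d r) (d t) (2 * r) q (+ q ℤ.- + (2 * r)) ([x-y]+y≡x q (2 * r))
        (≤-trans (maximal r 1≤r (≤-trans r≤ (⌈[1+2m∸t]/2⌉≤m m 1≤t))) (scaled-monoʳ t 2t≤q))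
      middle-bound : ∀ r → t ≤ r → r ≤ ⌊ (q + t) /2⌋ →
                     scaled r (2 * r + evenInd t) ≤ scaled t (2 * t + t)
      middle-bound r t≤r r≤ with r ≤? m
      ... | yes r≤m = ≤-trans (scaled-raise r t (2 * r) (2 * t) (evenInd t) (maximal r (≤-trans 1≤t t≤r) r≤m))
                              (scaled-monoʳ t (+-monoʳ-≤ (2 * t) (≤-trans (evenInd≤1 t) 1≤t)))
      ... | no r≰m = ≤-trans (scaled-antitoneˡ T r (2 * r + evenInd t) (≰⇒> r≰m))
                             (scaled-raise-≤ {T} {t} T-light′ (≤-trans (*-monoʳ-≤ 2 (≰⇒> r≰m)) (m≤m+n _ _))
                                             ([2r+evenInd]+[2t+1]≤[2t+t]+2T t r≤))
      middle : ∀ r → t ≤ r → r ≤ ⌊ (q + t) /2⌋ →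
               ScaledLe q n (d r) (d t) ((+ (2 * t) ℤ.- + (2 * r)) ℤ.+ (+ t ℤ.- + evenInd t))
      middle r t≤r r≤ = ScaledLe-intro q n (d r) (d t) (2 * r + evenInd t) (2 * t + t)
        ((+ (2 * t) ℤ.- + (2 * r)) ℤ.+ (+ t ℤ.- + evenInd t))
        ([x-y]+[z-w]+[y+w]≡x+z (2 * t) (2 * r) t (evenInd t)) (middle-bound r t≤r r≤)
      small : 2 * t < q → ScaledLe q n (d 1) (d t) (+ (2 * (t ∸ 1)))
      small _ = ScaledLe-intro q n (d 1) (d t) 2 (2 * t) (+ (2 * (t ∸ 1))) (cong +_ (2[t∸1]+2≡2t 1≤t))
                               (maximal 1 ≤-refl (≤-trans 1≤t t≤m))
      large : q < 2 * t → ScaledLe q n (d 1) (d t) (+ (q ∸ 2))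
      large q<2t = ⊥-elim (<⇒≱ q<2t 2t≤q)

    good-index : 1 ≤ m → ∃[ t ] 1 ≤ t × t ≤ q × Good q n d t
    good-index 1≤m with argmax-between weight m 1≤m
    ... | t , 1≤t , t≤m , maximal with n * weight t ≤? weight T
    ...   | yes T-heavy = T , s≤s z≤n , s≤s (m≤m+n m (m + 0)) ,
                          good-above 1≤m (λ r 1≤r r≤m → ≤-trans (*-monoʳ-≤ n (maximal r 1≤r r≤m)) T-heavy)
    ...   | no T-light = t , 1≤t , ≤-trans t≤m (m≤n⇒m≤1+n (m≤m+n m (m + 0))) ,
                       good-below 1≤t t≤m maximal (≰⇒> T-light)

  -- Extracting one approximately strongly regular piece

  module _ {n : ℕ} where

    _without_ : Hypergraph n → Subset n → Hypergraph n
    G without Q = filter (∁? (Q ⊆?_)) G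

    codeg-without : ∀ G Q → codeg (G without Q) Q ≡ 0
    codeg-without G Q = cong length (filter-none (Q ⊆?_) (all-filter (∁? (Q ⊆?_)) G))

    firstCentre : (T : List (Subset n)) → Subset n → Maybe (Fin (length T))
    firstCentre []      C = nothing
    firstCentre (Q ∷ T) C with Q ⊆? C
    ... | yes _ = just zero
    ... | no _  = Maybe.map suc (firstCentre T C)

    covered? : (T : List (Subset n)) → Decidable (Is-just ∘ firstCentre T)
    covered? T = is-just? ∘ firstCentre T

    uncovered : List (Subset n) → Hypergraph n → Hypergraph n
    uncovered T G = filter (∁? (covered? T)) G

    firstCentre-sound : ∀ T C j → firstCentre T C ≡ just j → lookup T j ⊆ C
    firstCentre-sound (Q ∷ T) C j found with Q ⊆? C
    firstCentre-sound (Q ∷ T) C zero refl | yes Q⊆C = Q⊆C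
    firstCentre-sound (Q ∷ T) C j found | no _ with firstCentre T C | firstCentre-sound T C
    firstCentre-sound (Q ∷ T) C (suc σ) refl | no _ | just σ | sound = sound σ refl

    class-zero : ∀ Q T G → piece (firstCentre (Q ∷ T)) G zero ≡ filter (Q ⊆?_) G
    class-zero Q T [] = refl
    class-zero Q T (C ∷ G) with Q ⊆? C
    ... | yes _ = cong (C ∷_) (class-zero Q T G)
    ... | no _ with firstCentre T C
    ...   | nothing = class-zero Q T G
    ...   | just _  = class-zero Q T G

    class-suc : ∀ Q T G j → piece (firstCentre (Q ∷ T)) G (suc j) ≡ piece (firstCentre T) (G without Q) j
    class-suc Q T [] j = refl
    class-suc Q T (C ∷ G) j with Q ⊆? C
    ... | yes _ = class-suc Q T G j
    ... | no _ with firstCentre T C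
    ...   | nothing = class-suc Q T G j
    ...   | just σ with σ Fin.≟ j
    ...     | yes _ = cong (C ∷_) (class-suc Q T G j)
    ...     | no _  = class-suc Q T G j

    covered-by-head : ∀ Q T {C} → Q ⊆ C → Is-just (firstCentre (Q ∷ T) C)
    covered-by-head Q T {C} Q⊆C with Q ⊆? C
    ... | yes _   = MaybeAny.just tt
    ... | no Q⊈C = ⊥-elim (Q⊈C Q⊆C)

    uncovered-∷ : ∀ Q T G → uncovered (Q ∷ T) G ≡ uncovered T (G without Q)
    uncovered-∷ Q T [] = refl
    uncovered-∷ Q T (C ∷ G) with Q ⊆? C
    ... | yes _ = uncovered-∷ Q T G
    ... | no _ with firstCentre T C
    ...   | nothing = cong (C ∷_) (uncovered-∷ Q T G)
    ...   | just _  = uncovered-∷ Q T G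

    module Greedy (threshold : ℕ) where

      centres : Hypergraph n → List (Subset n) → List (Subset n)
      centres R []       = []
      centres R (Q ∷ Qs) with threshold ≤? 2 * codeg R Q
      ... | yes _ = Q ∷ centres (R without Q) Qs
      ... | no _  = centres R Qs

      centres-all : ∀ {P : Subset n → Set} R {Qs} → All P Qs → All P (centres R Qs)
      centres-all R []                   = []
      centres-all R {Q ∷ Qs} (PQ ∷ PQs) with threshold ≤? 2 * codeg R Q
      ... | yes _ = PQ ∷ centres-all (R without Q) PQs
      ... | no _  = centres-all R PQs

      classes-large : ∀ R Qs j → threshold ≤ 2 * length (piece (firstCentre (centres R Qs)) R j)
      classes-large R (Q ∷ Qs) j with threshold ≤? 2 * codeg R Q
      classes-large R (Q ∷ Qs) zero    | yes large =
        subst (λ P → threshold ≤ 2 * length P) (sym (class-zero Q _ R)) large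
      classes-large R (Q ∷ Qs) (suc j) | yes _ =
        subst (λ P → threshold ≤ 2 * length P) (sym (class-suc Q _ R j)) (classes-large (R without Q) Qs j)
      classes-large R (Q ∷ Qs) j       | no _ = classes-large R Qs j

      uncovered-small : 1 ≤ threshold → ∀ R Qs {Q} → Q ∈ Qs →
                        2 * codeg (uncovered (centres R Qs) R) Q < threshold
      uncovered-small 1≤threshold R (Q′ ∷ Qs) Q∈ with threshold ≤? 2 * codeg R Q′
      uncovered-small 1≤threshold R (Q ∷ Qs) (here refl) | yes _ =
        subst (λ P → 2 * codeg P Q < threshold) (sym (uncovered-∷ Q _ R)) (begin-strict
          2 * codeg (uncovered T (R without Q)) Q  ≤⟨ *-monoʳ-≤ 2 (codeg-mono (Sublist.filter-⊆ _ (R without Q)) Q) ⟩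
          2 * codeg (R without Q) Q                ≡⟨ cong (2 *_) (codeg-without R Q) ⟩
          0                                        <⟨ 1≤threshold ⟩
          threshold                                ∎)
        where
        open ≤-Reasoning
        T : List (Subset n)
        T = centres (R without Q) Qs
      uncovered-small 1≤threshold R (Q′ ∷ Qs) (there Q∈) | yes _ =
        subst (λ P → 2 * codeg P _ < threshold) (sym (uncovered-∷ Q′ _ R))
          (uncovered-small 1≤threshold (R without Q′) Qs Q∈)
      uncovered-small 1≤threshold R (Q ∷ Qs) (here refl) | no small =
        ≤-<-trans (*-monoʳ-≤ 2 (codeg-mono (Sublist.filter-⊆ _ R) Q)) (≰⇒> small)
      uncovered-small 1≤threshold R (Q′ ∷ Qs) (there Q∈) | no _ = uncovered-small 1≤threshold R Qs Q∈

    -- Labels are attached to the hyperedges themselves rather than to their positions, so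
    -- parallel hyperedges always share a piece.
    labelled≡piece : ∀ {p} (G : Hypergraph n) (label : Subset n → Maybe (Fin p)) π →
                     labelled G (λ i → label (lookup G i)) π ≡ piece label G π
    labelled≡piece []      label π = refl
    labelled≡piece (C ∷ G) label π with label C
    ... | nothing = labelled≡piece G label π
    ... | just σ with σ Fin.≟ π
    ...   | yes _ = cong (C ∷_) (labelled≡piece G label π)
    ...   | no _  = labelled≡piece G label π

    length≤codeg : ∀ {G′ G : Hypergraph n} Q → All (Q ⊆_) G′ → G′ ⊑ G → length G′ ≤ codeg G Q
    length≤codeg {G′} {G} Q contain G′⊑G =
      subst (_≤ codeg G Q) (cong length (filter-all (Q ⊆?_) contain)) (codeg-mono G′⊑G Q)

    approxStronglyRegular-intro :
      ∀ {q t p} (P : Hypergraph n) (F : Subset n → Fin p) (centre : Fin p → Subset n) →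
      (∀ θ → ∣ centre θ ∣ ≡ t) → (∀ θ → All (centre θ ⊆_) (piece (just ∘ F) P θ)) →
      (∀ θ → dmax P t ≤ 2 * length (piece (just ∘ F) P θ)) → Good q n (dmax P) t →
      ApproxStronglyRegular q n t P
    approxStronglyRegular-intro {t = t} {p} P F centre sizes contain large good = p , F ∘ lookup P , class , good
      where
      class : ∀ θ → let Pθ = labelled P (λ i → just (F (lookup P i))) θ in
              (Σ (Subset n) λ Q → (∣ Q ∣ ≡ t) × All (Q ⊆_) Pθ)
              × (dmax P t ≤ 2 * length Pθ) × (length Pθ ≤ dmax P t)
      class θ rewrite labelled≡piece P (just ∘ F) θ =
        (centre θ , sizes θ , contain θ) , large θ ,
        ≤-trans (length≤codeg (centre θ) (contain θ) (Sublist.filter-⊆ _ P)) (codeg≤dmax P (centre θ) (sizes θ))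

    module Extraction (G : Hypergraph n) {t} (t≤n : t ≤ n) (1≤d : 1 ≤ dmax G t) where

      d : ℕ
      d = dmax G t

      Q* : Subset n
      Q* = proj₁ (dmax-attained G t≤n)

      ∣Q*∣≡t : ∣ Q* ∣ ≡ t
      ∣Q*∣≡t = proj₁ (proj₂ (dmax-attained G t≤n))

      codeg≡dmax : codeg G Q* ≡ d
      codeg≡dmax = proj₂ (proj₂ (dmax-attained G t≤n))

      open Greedy d using (centres; centres-all; uncovered-small)

      -- Q* comes first, so every hyperedge containing it is covered and d stays the t-th
      -- co-degree of the covered part.
      T′ T : List (Subset n)
      T′ = centres (G without Q*) (subsetsOfSize t)
      T  = Q* ∷ T′

      covered remainder : Hypergraph n
      covered   = filter (covered? T) G
      remainder = uncovered T G

      classes-large : ∀ θ → d ≤ 2 * length (piece (firstCentre T) G θ)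
      classes-large zero = subst (λ P → d ≤ 2 * length P) (sym (class-zero Q* T′ G))
                                 (subst (λ c → d ≤ 2 * c) (sym codeg≡dmax) (m≤m+n d (d + 0)))
      classes-large (suc j) = subst (λ P → d ≤ 2 * length P) (sym (class-suc Q* T′ G j))
                                    (Greedy.classes-large d (G without Q*) (subsetsOfSize t) j)

      covered-classes : ∀ θ →
                        piece (just ∘ fromMaybe zero ∘ firstCentre T) covered θ ≡ piece (firstCentre T) G θ
      covered-classes = piece-fromMaybe (firstCentre T) G

      dmax-covered≤ : ∀ r → dmax covered r ≤ dmax G r
      dmax-covered≤ = dmax-mono (Sublist.filter-⊆ (covered? T) G)

      d≤dmax-covered : d ≤ dmax covered t
      d≤dmax-covered = begin
        d                 ≡⟨ codeg≡dmax ⟨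
        codeg G Q*        ≡⟨ cong length (filter-absorb (Q* ⊆?_) (covered? T) (covered-by-head Q* T′) G) ⟨
        codeg covered Q*  ≤⟨ codeg≤dmax covered Q* ∣Q*∣≡t ⟩
        dmax covered t    ∎
        where open ≤-Reasoning

      covered-regular : ∀ {q} → Good q n (dmax G) t → ApproxStronglyRegular q n t covered
      covered-regular {q} good =
        approxStronglyRegular-intro covered (fromMaybe zero ∘ firstCentre T) (lookup T) sizes contain large
          (Good-mono {q} {n} {dmax G} {dmax covered} {t} good d≤dmax-covered dmax-covered≤)
        where
        sizes : ∀ θ → ∣ lookup T θ ∣ ≡ t
        sizes θ = All.lookup (∣Q*∣≡t ∷ centres-all _ (all-filter (λ Q → ∣ Q ∣ ℕ.≟ t) (allSubsets n))) (∈-lookup θ)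
        contain : ∀ θ → All (lookup T θ ⊆_) (piece (just ∘ fromMaybe zero ∘ firstCentre T) covered θ)
        contain θ = subst (All (lookup T θ ⊆_)) (sym (covered-classes θ))
                          (All.map (firstCentre-sound T _ θ) (all-piece (firstCentre T) G θ))
        large : ∀ θ → dmax covered t ≤ 2 * length (piece (just ∘ fromMaybe zero ∘ firstCentre T) covered θ)
        large θ = ≤-trans (dmax-covered≤ t)
                          (subst (λ P → d ≤ 2 * length P) (sym (covered-classes θ)) (classes-large θ))

      remainder-small : 2 * dmax remainder t < d
      remainder-small =
        let Q , ∣Q∣≡t , attains = dmax-attained remainder t≤n in
        subst (λ c → 2 * c < d) attains
          (subst (λ R → 2 * codeg R Q < d) (sym (uncovered-∷ Q* T′ G))
            (uncovered-small 1≤d (G without Q*) (subsetsOfSize t) (∈-subsetsOfSize Q ∣Q∣≡t)))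

  -- The potential Σ_r ⌈log₂ d_r⌉ and the decomposition

  sumTo : ℕ → (ℕ → ℕ) → ℕ
  sumTo zero    f = 0
  sumTo (suc k) f = f (suc k) + sumTo k f

  sumTo-mono : ∀ k {f g} → (∀ r → f r ≤ g r) → sumTo k f ≤ sumTo k g
  sumTo-mono zero    f≤g = z≤n
  sumTo-mono (suc k) f≤g = +-mono-≤ (f≤g (suc k)) (sumTo-mono k f≤g)

  sumTo-mono-< : ∀ k f g {t} → 1 ≤ t → t ≤ k → (∀ r → f r ≤ g r) → f t < g t → sumTo k f < sumTo k g
  sumTo-mono-< zero    f g (s≤s _) () _ _
  sumTo-mono-< (suc k) f g {t} 1≤t t≤1+k f≤g ft<gt with m≤n⇒m<n∨m≡n t≤1+k
  ... | inj₂ refl = +-mono-<-≤ ft<gt (sumTo-mono k f≤g)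
  ... | inj₁ t<1+k = +-mono-≤-< (f≤g (suc k)) (sumTo-mono-< k f g 1≤t (s≤s⁻¹ t<1+k) f≤g ft<gt)

  sumTo≤* : ∀ k {f b} → (∀ r → f r ≤ b) → sumTo k f ≤ k * b
  sumTo≤* zero    f≤b = z≤n
  sumTo≤* (suc k) f≤b = +-mono-≤ (f≤b (suc k)) (sumTo≤* k f≤b)

  2*m<n⇒⌈log₂m⌉<⌈log₂n⌉ : ∀ {m n} → 1 ≤ m → 2 * m < n → ⌈log₂ m ⌉ < ⌈log₂ n ⌉
  2*m<n⇒⌈log₂m⌉<⌈log₂n⌉ {suc m} {n} _ 2m<n =
    subst (_≤ ⌈log₂ n ⌉) (⌈log₂2*n⌉≡1+⌈log₂n⌉ (suc m)) (⌈log₂⌉-mono-≤ (<⇒≤ 2m<n))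

  potential : ∀ {n} → ℕ → Hypergraph n → ℕ
  potential q G = sumTo q (λ r → ⌈log₂ dmax G r ⌉)

  potential≤ : ∀ {n} q (G : Hypergraph n) → potential q G ≤ q * ⌈log₂ length G ⌉
  potential≤ q G = sumTo≤* q (λ r → ⌈log₂⌉-mono-≤ (dmax≤length G r))

  Regular : ∀ {n} → ℕ → Hypergraph n → Set
  Regular {n} q P = Σ ℕ λ t → 1 ≤ t × t ≤ q × ApproxStronglyRegular q n t P

  module _ (m : ℕ) {n} {G : Hypergraph n} (G≢[] : G ≢ []) (uniform : Uniform (suc (2 * m)) G) where

    peel-at : ∀ {t} → 1 ≤ t → t ≤ suc (2 * m) → Good (suc (2 * m)) n (dmax G) t →
              Peeling.Peel (Regular (suc (2 * m))) (Uniform (suc (2 * m))) (potential (suc (2 * m))) G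
    peel-at {t} 1≤t t≤q good = record
      { taken?     = covered? T
      ; accepted   = t , 1≤t , t≤q , covered-regular {suc (2 * m)} good
      ; invariant  = All.filter⁺ (∁? (covered? T)) uniform
      ; decreasing = λ remainder≢[] →
          sumTo-mono-< (suc (2 * m)) (λ r → ⌈log₂ dmax remainder r ⌉) (λ r → ⌈log₂ dmax G r ⌉) 1≤t t≤q
            (λ r → ⌈log₂⌉-mono-≤ (dmax-mono (Sublist.filter-⊆ (∁? (covered? T)) G) r))
            (2*m<n⇒⌈log₂m⌉<⌈log₂n⌉ {dmax remainder t} {dmax G t}
              (dmax-positive (All.filter⁺ (∁? (covered? T)) uniform) remainder≢[] t≤q) remainder-small) }
      where
      open Extraction G (≤-trans t≤q (edge-size≤n uniform G≢[])) (dmax-positive uniform G≢[] t≤q)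

  peel-regular : ∀ m → 1 ≤ m → ∀ {n} {G : Hypergraph n} → G ≢ [] → Uniform (suc (2 * m)) G →
                 Peeling.Peel (Regular (suc (2 * m))) (Uniform (suc (2 * m))) (potential (suc (2 * m))) G
  peel-regular m 1≤m {n} {G} G≢[] uniform =
    let t , 1≤t , t≤q , good = GoodIndex.good-index m n {{n≢0}} (dmax G) (dmax-antitone G) 1≤m
    in peel-at m G≢[] uniform 1≤t t≤q good
    where
    n≢0 : NonZero n
    n≢0 = >-nonZero (≤-trans (s≤s z≤n) (edge-size≤n uniform G≢[]))

  odd≥3⇒1+2m : ∀ q → q ≥ 3 → q % 2 ≡ 1 → ∃[ m ] 1 ≤ m × q ≡ suc (2 * m)
  odd≥3⇒1+2m q q≥3 q-odd =
    q ℕ./ 2 , ℕ./-monoˡ-≤ 2 q≥3 , trans (ℕ.m≡m%n+[m/n]*n q 2) (cong₂ _+_ q-odd (*-comm (q ℕ./ 2) 2))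

  regular-decomposition : ∀ q → q ≥ 3 → q % 2 ≡ 1 → ∀ X Y {n} (H : Hypergraph n) → Uniform q H →
    Peeling.Decomposition (Regular q) X Y H (q * ⌈log₂ length H ⌉ + 1)
  regular-decomposition q q≥3 q-odd X Y H uniform with odd≥3⇒1+2m q q≥3 q-odd
  ... | m , 1≤m , refl =
    Peeling.decompose (Regular q) X Y (peel-regular m 1≤m) _ H uniform
      (λ _ → ≤-<-trans (potential≤ q H) (m<m+n _ (s≤s z≤n)))

open import Defs
open import Data.Nat using (ℕ; suc; _+_; _*_; _≤_; _≥_; _%_)
import Data.Nat as ℕ
import Data.Nat.Properties as ℕ
import Data.Nat.GCD as ℕ
open import Data.Nat.Tactic.RingSolver using (solve-∀)
open import Algebra.Properties.CommutativeSemigroup ℕ.*-commutativeSemigroup using (x∙yz≈y∙xz)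
open import Data.Nat.Logarithm using (⌈log₂_⌉)
open import Data.Nat.ListAction using (sum)
open import Data.Integer using (ℤ; +_; -[1+_])
import Data.Integer as ℤ
import Data.Integer.Properties as ℤ
import Data.Integer.GCD as ℤ
import Data.Integer.Tactic.RingSolver as ℤ-Solver
open import Data.Rational using (ℚ; mkℚ; _/_; 0ℚ; 1ℚ; _-_; _<_; toℚᵘ; ↥_; ↧_; ↧ₙ_)
import Data.Rational as ℚ
import Data.Rational.Properties as ℚ
open import Data.Rational.Unnormalised using (mkℚᵘ; *≡*; *≤*)
import Data.Rational.Unnormalised as ℚᵘ
import Data.Rational.Unnormalised.Properties as ℚᵘ
open import Data.Fin using (Fin)
open import Data.List using (length; lookup; map; allFin)
open import Data.List.Properties using (map-cong)
open import Data.Maybe using (Maybe)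
open import Data.Product using (Σ; ∃-syntax; _×_; _,_; proj₁; proj₂)
open import Data.Empty using (⊥-elim)
open import Function using (_∘_)
open import Relation.Binary.PropositionalEquality using (_≡_; refl; sym; trans; cong; cong₂; subst; subst₂)
open Labellings using (coverage; module Peeling)
open Regularisation using (Regular; regular-decomposition; labelled≡piece)

-- Rational bounds

fromℕ : ℕ → ℚ
fromℕ n = (+ n) / 1

-- (+ n) / 1 is normalised through a gcd, so it does not reduce for a variable n.
gcd[n,1]≡1 : ∀ n → ℤ.gcd (+ n) (+ 1) ≡ + 1
gcd[n,1]≡1 n = cong +_ (ℕ.gcd-zeroʳ n)

↥-fromℕ : ∀ n → ↥ fromℕ n ≡ + n
↥-fromℕ n =
  trans (sym (ℤ.*-identityʳ _)) (trans (cong (ℤ._*_ (↥ fromℕ n)) (sym (gcd[n,1]≡1 n))) (ℚ.↥-/ (+ n) 1))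

↧-fromℕ : ∀ n → ↧ fromℕ n ≡ + 1
↧-fromℕ n =
  trans (sym (ℤ.*-identityʳ _)) (trans (cong (ℤ._*_ (↧ fromℕ n)) (sym (gcd[n,1]≡1 n))) (ℚ.↧-/ (+ n) 1))

toℚᵘ-fromℕ : ∀ n → toℚᵘ (fromℕ n) ℚᵘ.≃ mkℚᵘ (+ n) 0
toℚᵘ-fromℕ n = *≡* (trans (cong (ℤ._* + 1) (trans (ℚ.↥ᵘ-toℚᵘ (fromℕ n)) (↥-fromℕ n)))
                          (cong (ℤ._*_ (+ n)) (sym (trans (ℚ.↧ᵘ-toℚᵘ (fromℕ n)) (↧-fromℕ n)))))

fromℕ-* : ∀ m n → fromℕ (m * n) ≡ fromℕ m ℚ.* fromℕ n
fromℕ-* m n = ℚ.toℚᵘ-injective (begin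
  toℚᵘ (fromℕ (m * n))                ≈⟨ toℚᵘ-fromℕ (m * n) ⟩
  mkℚᵘ (+ (m * n)) 0                  ≈⟨ *≡* (cong (ℤ._* + 1) (ℤ.pos-* m n)) ⟩
  mkℚᵘ (+ m) 0 ℚᵘ.* mkℚᵘ (+ n) 0      ≈⟨ ℚᵘ.*-cong (toℚᵘ-fromℕ m) (toℚᵘ-fromℕ n) ⟨
  toℚᵘ (fromℕ m) ℚᵘ.* toℚᵘ (fromℕ n)  ≈⟨ ℚ.toℚᵘ-homo-* (fromℕ m) (fromℕ n) ⟨
  toℚᵘ (fromℕ m ℚ.* fromℕ n)          ∎)
  where open ℚᵘ.≃-Reasoning

η*fromℕ≤fromℕ : ∀ η → 0ℚ ℚ.≤ η → ∀ N M → ℤ.∣ ↥ η ∣ * N ≤ ↧ₙ η * M → η ℚ.* fromℕ N ℚ.≤ fromℕ M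
η*fromℕ≤fromℕ (mkℚ -[1+ _ ] _ _) 0≤η = ⊥-elim (ℚ.<-irrefl refl (ℚ.<-≤-trans (ℚ.negative⁻¹ _) 0≤η))
η*fromℕ≤fromℕ η@(mkℚ (+ a) b _) _ N M aN≤[1+b]M = ℚ.toℚᵘ-cancel-≤ (begin
  toℚᵘ (η ℚ.* fromℕ N)            ≃⟨ ℚ.toℚᵘ-homo-* η (fromℕ N) ⟩
  toℚᵘ η ℚᵘ.* toℚᵘ (fromℕ N)      ≃⟨ ℚᵘ.*-congˡ {toℚᵘ η} (toℚᵘ-fromℕ N) ⟩
  mkℚᵘ (+ a) b ℚᵘ.* mkℚᵘ (+ N) 0  ≤⟨ *≤* (subst₂ ℤ._≤_ lhs rhs (ℤ.+≤+ aN≤[1+b]M)) ⟩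
  mkℚᵘ (+ M) 0                    ≃⟨ toℚᵘ-fromℕ M ⟨
  toℚᵘ (fromℕ M)                  ∎)
  where
  open ℚᵘ.≤-Reasoning
  lhs : + (a * N) ≡ (+ a ℤ.* + N) ℤ.* + 1
  lhs = trans (ℤ.pos-* a N) (sym (ℤ.*-identityʳ _))
  commute : ∀ b M → suc b * M ≡ M * suc (b * 1)
  commute = solve-∀
  rhs : + (suc b * M) ≡ + M ℤ.* + suc (b * 1)
  rhs = trans (cong +_ (commute b M)) (ℤ.pos-* M (suc (b * 1)))

[1-η]*fromℕ≤fromℕ : ∀ η → 0ℚ ℚ.≤ η → ∀ N C → ↧ₙ η * N ≤ ↧ₙ η * C + ℤ.∣ ↥ η ∣ * N →
                    (1ℚ - η) ℚ.* fromℕ N ℚ.≤ fromℕ C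
[1-η]*fromℕ≤fromℕ (mkℚ -[1+ _ ] _ _) 0≤η = ⊥-elim (ℚ.<-irrefl refl (ℚ.<-≤-trans (ℚ.negative⁻¹ _) 0≤η))
[1-η]*fromℕ≤fromℕ η@(mkℚ (+ a) b _) _ N C [1+b]N≤[1+b]C+aN = ℚ.toℚᵘ-cancel-≤ unnormalised
  where
  expand : ∀ (s a x : ℤ) → ((+ 1 ℤ.* s ℤ.+ ℤ.- a ℤ.* + 1) ℤ.* x) ℤ.* + 1 ≡ s ℤ.* x ℤ.- a ℤ.* x
  expand = ℤ-Solver.solve-∀
  cancel : ∀ (x y : ℤ) → (x ℤ.+ y) ℤ.- y ≡ x
  cancel = ℤ-Solver.solve-∀
  commute : ∀ b C → suc b * C ≡ C * suc ((b + 0) * 1)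
  commute = solve-∀
  cross : ((+ 1 ℤ.* + suc b ℤ.+ ℤ.- + a ℤ.* + 1) ℤ.* + N) ℤ.* + 1 ℤ.≤ + C ℤ.* + suc ((b + 0) * 1)
  cross = begin
    ((+ 1 ℤ.* + suc b ℤ.+ ℤ.- + a ℤ.* + 1) ℤ.* + N) ℤ.* + 1 ≡⟨ expand (+ suc b) (+ a) (+ N) ⟩
    + suc b ℤ.* + N ℤ.- + a ℤ.* + N                          ≡⟨ cong₂ ℤ._-_ (ℤ.pos-* (suc b) N) (ℤ.pos-* a N) ⟨
    + (suc b * N) ℤ.- + (a * N)                              ≤⟨ ℤ.+-monoˡ-≤ (ℤ.- + (a * N)) (ℤ.+≤+ [1+b]N≤[1+b]C+aN) ⟩
    + (suc b * C + a * N) ℤ.- + (a * N)                      ≡⟨ cong (ℤ._- + (a * N)) (ℤ.pos-+ (suc b * C) (a * N)) ⟩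
    (+ (suc b * C) ℤ.+ + (a * N)) ℤ.- + (a * N)              ≡⟨ cancel (+ (suc b * C)) (+ (a * N)) ⟩
    + (suc b * C)                                            ≡⟨ cong +_ (commute b C) ⟩
    + (C * suc ((b + 0) * 1))                                ≡⟨ ℤ.pos-* C _ ⟩
    + C ℤ.* + suc ((b + 0) * 1)                              ∎
    where open ℤ.≤-Reasoning
  1-η : toℚᵘ (1ℚ - η) ℚᵘ.≃ mkℚᵘ (+ 1) 0 ℚᵘ.+ mkℚᵘ (ℤ.- + a) b
  1-η = ℚᵘ.≃-trans (ℚ.toℚᵘ-homo-+ 1ℚ (ℚ.- η)) (ℚᵘ.+-congʳ (toℚᵘ 1ℚ) (ℚ.toℚᵘ-homo‿- η))
  unnormalised : toℚᵘ ((1ℚ - η) ℚ.* fromℕ N) ℚᵘ.≤ toℚᵘ (fromℕ C)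
  unnormalised = begin
    toℚᵘ ((1ℚ - η) ℚ.* fromℕ N)                              ≃⟨ ℚ.toℚᵘ-homo-* (1ℚ - η) (fromℕ N) ⟩
    toℚᵘ (1ℚ - η) ℚᵘ.* toℚᵘ (fromℕ N)                        ≃⟨ ℚᵘ.*-cong 1-η (toℚᵘ-fromℕ N) ⟩
    (mkℚᵘ (+ 1) 0 ℚᵘ.+ mkℚᵘ (ℤ.- + a) b) ℚᵘ.* mkℚᵘ (+ N) 0  ≤⟨ *≤* cross ⟩
    mkℚᵘ (+ C) 0                                             ≃⟨ toℚᵘ-fromℕ C ⟨
    toℚᵘ (fromℕ C)                                           ∎
    where open ℚᵘ.≤-Reasoning

cancel-budget : ∀ B {a b N c e} → .{{_ : ℕ.NonZero B}} → e ≤ B →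
                B * b * N ≤ B * b * c + e * (a * N) → b * N ≤ b * c + a * N
cancel-budget B {a} {b} {N} {c} {e} e≤B covering = ℕ.*-cancelˡ-≤ B (begin
  B * (b * N)               ≡⟨ ℕ.*-assoc B b N ⟨
  B * b * N                 ≤⟨ covering ⟩
  B * b * c + e * (a * N)   ≤⟨ ℕ.+-monoʳ-≤ (B * b * c) (ℕ.*-monoˡ-≤ (a * N) e≤B) ⟩
  B * b * c + B * (a * N)   ≡⟨ cong (_+ B * (a * N)) (ℕ.*-assoc B b c) ⟩
  B * (b * c) + B * (a * N) ≡⟨ ℕ.*-distribˡ-+ B (b * c) (a * N) ⟨
  B * (b * c + a * N)       ∎)
  where open ℕ.≤-Reasoning

lemma4p7 : (q n : ℕ) → q ≥ 3 → q % 2 ≡ 1 →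
    (H : Hypergraph n) → Uniform q H →
    (η : ℚ) → 0ℚ < η →
    Σ ℕ λ p → Σ (Fin (length H) → Maybe (Fin p)) λ f →
      (p ≤ q * ⌈log₂ length H ⌉ + 1)
      × (∀ π → Σ ℕ λ t → (1 ≤ t) × (t ≤ q) × ApproxStronglyRegular q n t (labelled H f π))
      × (((1ℚ - η) ℚ.* ((+ length H) / 1))
           ℚ.≤ ((+ sum (map (λ π → length (labelled H f π)) (allFin p))) / 1))
      × (∀ π → (η ℚ.* ((+ length H) / 1))
           ℚ.≤ ((+ (q * ⌈log₂ length H ⌉ + 1)) / 1) ℚ.* ((+ length (labelled H f π)) / 1))
lemma4p7 q n q≥3 q-odd H uniform η 0<η =
  pieces , label ∘ lookup H ,
  ℕ.≤-trans (ℕ.m≤m+n pieces dropped) within-budget ,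
  (λ π → subst (Regular q) (sym (labelled≡piece H label π)) (proj₁ (admissible π))) ,
  subst (λ c → (1ℚ - η) ℚ.* fromℕ N ℚ.≤ fromℕ c) (sym covered≡coverage)
    ([1-η]*fromℕ≤fromℕ η 0≤η N _
      (cancel-budget B {a} {b} {N} (ℕ.≤-trans (ℕ.m≤n+m dropped pieces) within-budget) nearly-covering)) ,
  λ π → subst (λ P → η ℚ.* fromℕ N ℚ.≤ fromℕ B ℚ.* fromℕ (length P)) (sym (labelled≡piece H label π))
          (subst (η ℚ.* fromℕ N ℚ.≤_) (fromℕ-* B _)
            (η*fromℕ≤fromℕ η 0≤η N _
              (subst (a * N ≤_) (trans (ℕ.*-assoc B b _) (x∙yz≈y∙xz B b _)) (proj₂ (admissible π)))))
  where
  N B a b : ℕ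
  N = length H
  B = q * ⌈log₂ N ⌉ + 1
  a = ℤ.∣ ↥ η ∣
  b = ↧ₙ η
  instance
    B≢0 : ℕ.NonZero B
    B≢0 = ℕ.>-nonZero (ℕ.m≤n+m 1 (q * ⌈log₂ N ⌉))
  0≤η : 0ℚ ℚ.≤ η
  0≤η = ℚ.<⇒≤ 0<η
  -- With η = a / b, a piece is kept iff a N ≤ B b |piece|, i.e. |piece| ≥ η N / B.
  open Peeling.Decomposition (regular-decomposition q q≥3 q-odd (a * N) (B * b) H uniform)
  covered≡coverage :
    sum (map (λ π → length (labelled H (label ∘ lookup H) π)) (allFin pieces)) ≡ coverage label H
  covered≡coverage = cong sum (map-cong (λ π → cong length (labelled≡piece H label π)) (allFin pieces))
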